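{- Let $B$ and $C$ be bounded complete predomain bases such that $\ll$ is decidable on $C$, and let $f:\hat B\to\hat C$ be a function such that $f^{ -1}(O)$ is Scott-open for every Scott-open $O\subseteq\hat C$. Then $f$ is Scott continuous.
   Context: Work constructively; $\tilde\exists x.A$ abbreviates $\neg\forall x.\neg A$. In a poset, a chain is a sequence $(x_n)$ with $x_n\sqsubseteq x_{n+1}$; $b\ll c$ means: for every chain $(x_n)$ whose supremum exists and satisfies $c\sqsubseteq\bigsqcup_n x_n$, there weakly exists $n$ with $b\sqsubseteq x_n$. An approximating sequence of $b$ is a chain $(b_n)$ with $b_n\ll b$ and $\bigsqcup_n b_n=b$. A predomain base is a countable poset with decidable order in which every element has an approximating sequence; it is bounded complete if every finite subset that weakly has an upper bound has a least upper bound. The continuous completion $\hat B$ is the set of increasing sequences in $B$, preordered by $(b_n)\sqsubseteq(b'_n)$ iff for all $b\in B$, $n$, $b\ll b_n$ implies $\tilde\exists m.\,b\ll b'_m$; equality is mutual $\sqsubseteq$; functions on $\hat B$ are assumed to respect this equality. A map $f$ is Scott continuous if it is monotone and $f(\bigsqcup_n x_n)=\bigsqcup_n f(x_n)$ for all chains whenever these suprema exist. A subset $O$ of a poset is Scott-open if it is an upper set and whenever $(x_n)$ is a chain with $\bigsqcup_n x_n\in O$, there weakly exists $k$ with $x_k\in O$. -}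

module Defs where

open import Data.Nat using (ℕ; suc)
open import Data.Product using (Σ; _×_; _,_; proj₁; proj₂; ∃)
open import Data.Maybe using (Maybe; just)
open import Data.List using (List)
open import Data.List.Relation.Unary.All using (All)
open import Relation.Nullary using (¬_; Dec)
open import Relation.Binary.PropositionalEquality using (_≡_)

∃̃ : {A : Set} → (A → Set) → Set
∃̃ {A} P = ¬ ((x : A) → ¬ P x)

module Order {A : Set} (_⊑_ : A → A → Set) where

  Chain : (ℕ → A) → Set
  Chain x = (n : ℕ) → x n ⊑ x (suc n)

  IsSup : (ℕ → A) → A → Set
  IsSup x s = ((n : ℕ) → x n ⊑ s) × ((u : A) → ((n : ℕ) → x n ⊑ u) → s ⊑ u)

  _≪_ : A → A → Set
  b ≪ c = (x : ℕ → A) → Chain x → (s : A) → IsSup x s → c ⊑ s →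
          ∃̃ (λ (n : ℕ) → b ⊑ x n)

  IsApproxSeq : (ℕ → A) → A → Set
  IsApproxSeq bs b = Chain bs × ((n : ℕ) → bs n ≪ b) × IsSup bs b

  Monotone : {A' : Set} (_⊑'_ : A' → A' → Set) → (A → A') → Set
  Monotone _⊑'_ f = (x y : A) → x ⊑ y → f x ⊑' f y

  ScottOpen : (A → Set) → Set
  ScottOpen O = ((x y : A) → x ⊑ y → O x → O y)
              × ((x : ℕ → A) → Chain x → (s : A) → IsSup x s → O s →
                 ∃̃ (λ (k : ℕ) → O (x k)))

ScottContinuous : {A A' : Set} (_⊑_ : A → A → Set) (_⊑'_ : A' → A' → Set) →
                  (A → A') → Set
ScottContinuous {A} {A'} _⊑_ _⊑'_ f =
  Order.Monotone _⊑_ _⊑'_ f ×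
  ((x : ℕ → A) → Order.Chain _⊑_ x → (s : A) → Order.IsSup _⊑_ x s →
   (t : A') → Order.IsSup _⊑'_ (λ n → f (x n)) t →
   (f s ⊑' t) × (t ⊑' f s))

record PredomainBase : Set₁ where
  field
    Carrier : Set
    _⊑_     : Carrier → Carrier → Set
    ⊑-dec   : (a b : Carrier) → Dec (a ⊑ b)
    ⊑-refl  : (a : Carrier) → a ⊑ a
    ⊑-trans : (a b c : Carrier) → a ⊑ b → b ⊑ c → a ⊑ c
    ⊑-antisym : (a b : Carrier) → a ⊑ b → b ⊑ a → a ≡ b
    -- countable: enumerated (possibly with gaps) by ℕ
    enum    : ℕ → Maybe Carrier
    enum-surj : (b : Carrier) → ∃ (λ n → enum n ≡ just b)
    approx  : (b : Carrier) → Σ (ℕ → Carrier) (λ bs → Order.IsApproxSeq _⊑_ bs b)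

  open Order _⊑_ public

BoundedComplete : PredomainBase → Set
BoundedComplete B = (l : List Carrier) →
  ∃̃ (λ u → All (_⊑ u) l) →
  Σ Carrier (λ s → All (_⊑ s) l × ((u : Carrier) → All (_⊑ u) l → s ⊑ u))
  where open PredomainBase B

WayBelowDecidable : PredomainBase → Set
WayBelowDecidable B = (a b : Carrier) → Dec (a ≪ b)
  where open PredomainBase B

Completion : PredomainBase → Set
Completion B = Σ (ℕ → Carrier) Chain
  where open PredomainBase B

⊑̂ : (B : PredomainBase) → Completion B → Completion B → Set
⊑̂ B x y = (b : Carrier) (n : ℕ) → b ≪ proj₁ x n → ∃̃ (λ m → b ≪ proj₁ y m)
  where open PredomainBase B

≈̂ : (B : PredomainBase) → Completion B → Completion B → Set
≈̂ B x y = ⊑̂ B x y × ⊑̂ B y x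

RespectsEq : (B C : PredomainBase) → (Completion B → Completion C) → Set
RespectsEq B C f = (x y : Completion B) → ≈̂ B x y → ≈̂ C (f x) (f y)

module Submission where

-- For c in the base C let  ↑c = { z ∈ Ĉ | ∃̃ m. c ≪ zₘ }.
-- (1) For any f : B̂ → Ĉ, if every preimage f⁻¹(↑c) is Scott-open then f is
--     Scott continuous: monotonicity comes from f⁻¹(↑c) being upper sets, and
--     f(⊔ xₙ) ⊑ ⊔ f(xₙ) from their inaccessibility by suprema of chains.
-- (2) If C is bounded complete, every ↑c is Scott-open in Ĉ.  Given a chain
--     (xₖ) in Ĉ we build an upper bound û ∈ Ĉ each of whose entries is way
--     below some entry xₖⱼ; then c ≪ (⊔ xₖ)ₘ forces c ≪ ûₙ ⊑ xₖⱼ for some n.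
-- Both û and the interpolation property  b ≪ a ⇒ ∃̃ i. b ≪ aᵢ  for an
-- approximating sequence (aᵢ) of a, which (2) needs, come from one
-- construction: running joins of an enumerated family inside a region of C
-- closed under binary joins.

open import Defs
open import Data.Product using (_×_; Σ; _,_; proj₁; proj₂; ∃)
open import Data.Nat using (ℕ; zero; suc; _+_; _≤_; _⊔_)
open import Data.Nat.Base using (_≤′_; ≤′-refl; ≤′-step)
open import Data.Nat.Properties using (+-suc; +-identityʳ; m≤m⊔n; m≤n⊔m; ≤⇒≤′)
open import Data.List using ([]; _∷_)
open import Data.List.Relation.Unary.All using ([]; _∷_)
open import Relation.Nullary using (Dec; yes; no)
open import Relation.Nullary.Decidable using (decidable-stable)
open import Relation.Binary.PropositionalEquality
  using (_≡_; refl; cong; sym; trans; module ≡-Reasoning)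
open import Data.Empty using (⊥-elim)

∃̃-intro : {A : Set} {P : A → Set} (a : A) → P a → ∃̃ P
∃̃-intro a p h = h a p

∃̃-bind : {A A' : Set} {P : A → Set} {Q : A' → Set} →
         ∃̃ P → ((a : A) → P a → ∃̃ Q) → ∃̃ Q
∃̃-bind e k h = e (λ a p → k a p h)

∃̃-elim : {A Q : Set} {P : A → Set} → Dec Q → ∃̃ P → ((a : A) → P a → Q) → Q
∃̃-elim Q? e k = decidable-stable Q? (λ ¬q → e (λ a p → ¬q (k a p)))

Enumeration : Set → Set
Enumeration I = Σ (ℕ → I) (λ σ → (t : I) → ∃ (λ n → σ n ≡ t))

-- ℕ × ℕ is enumerated diagonal by diagonal: (0,s), (1,s-1), …, (s,0), (0,s+1), …

nextPair : ℕ × ℕ → ℕ × ℕ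
nextPair (i , zero)  = (zero , suc i)
nextPair (i , suc j) = (suc i , j)

pairAt : ℕ → ℕ × ℕ
pairAt zero    = (zero , zero)
pairAt (suc n) = nextPair (pairAt n)

pairAt-walk : (i j n : ℕ) → pairAt n ≡ (zero , i + j) → pairAt (n + i) ≡ (i , j)
pairAt-walk zero j n p = trans (cong pairAt (+-identityʳ n)) p
pairAt-walk (suc i) j n p = begin
  pairAt (n + suc i)       ≡⟨ cong pairAt (+-suc n i) ⟩
  nextPair (pairAt (n + i)) ≡⟨ cong nextPair (pairAt-walk i (suc j) n p′) ⟩
  (suc i , j)              ∎
  where
  open ≡-Reasoning
  p′ : pairAt n ≡ (zero , i + suc j)
  p′ = trans p (cong (zero ,_) (sym (+-suc i j)))

pairAt-diagonal : (s : ℕ) → ∃ (λ n → pairAt n ≡ (zero , s))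
pairAt-diagonal zero = zero , refl
pairAt-diagonal (suc s) with pairAt-diagonal s
... | n , p = suc (n + s) ,
  cong nextPair (pairAt-walk s zero n (trans p (cong (zero ,_) (sym (+-identityʳ s)))))

enumℕ² : Enumeration (ℕ × ℕ)
enumℕ² = pairAt , λ { (i , j) → reach i j }
  where
  reach : (i j : ℕ) → ∃ (λ n → pairAt n ≡ (i , j))
  reach i j with pairAt-diagonal (i + j)
  ... | n , p = n + i , pairAt-walk i j n p

enum-× : {I J : Set} → Enumeration I → Enumeration J → Enumeration (I × J)
enum-× {I} {J} (σ , σ-onto) (τ , τ-onto) =
  (λ n → σ (proj₁ (pairAt n)) , τ (proj₂ (pairAt n))) , onto
  where
  onto : (t : I × J) → ∃ (λ n → (σ (proj₁ (pairAt n)) , τ (proj₂ (pairAt n))) ≡ t)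
  onto (a , b) with σ-onto a | τ-onto b
  ... | i , refl | j , refl with proj₂ enumℕ² (i , j)
  ...   | n , p = n , cong (λ q → σ (proj₁ q) , τ (proj₂ q)) p

enumℕ³ : Enumeration (ℕ × ℕ × ℕ)
enumℕ³ = enum-× ((λ n → n) , λ n → n , refl) enumℕ²

chain-mono : {A : Set} (_≤A_ : A → A → Set) →
  ((a : A) → a ≤A a) → ((a b c : A) → a ≤A b → b ≤A c → a ≤A c) →
  (x : ℕ → A) → Order.Chain _≤A_ x → {i j : ℕ} → i ≤ j → x i ≤A x j
chain-mono _≤A_ refl′ trans′ x x-chain i≤j = go (≤⇒≤′ i≤j)
  where
  go : ∀ {i j} → i ≤′ j → x i ≤A x j
  go ≤′-refl            = refl′ _
  go (≤′-step {n} i≤′n) = trans′ _ _ _ (go i≤′n) (x-chain n)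

module WayBelow (B : PredomainBase) where
  open PredomainBase B

  -- Way-below implies below (test b ≪ a against the constant chain at a).
  ≪⇒⊑ : {b a : Carrier} → b ≪ a → b ⊑ a
  ≪⇒⊑ {b} {a} b≪a with ⊑-dec b a
  ... | yes b⊑a = b⊑a
  ... | no b⋢a = ⊥-elim (b≪a (λ _ → a) (λ _ → ⊑-refl a) a
                         ((λ _ → ⊑-refl a) , (λ u a⊑u → a⊑u 0)) (⊑-refl a) (λ _ → b⋢a))

  ⊑-≪-trans : {b b' a : Carrier} → b ⊑ b' → b' ≪ a → b ≪ a
  ⊑-≪-trans {b} {b'} b⊑b' b'≪a x x-chain s s-sup a⊑s =
    ∃̃-bind (b'≪a x x-chain s s-sup a⊑s)
      (λ n b'⊑xn → ∃̃-intro n (⊑-trans b b' (x n) b⊑b' b'⊑xn))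

  ≪-⊑-trans : {b a a' : Carrier} → b ≪ a → a ⊑ a' → b ≪ a'
  ≪-⊑-trans {a = a} {a'} b≪a a⊑a' x x-chain s s-sup a'⊑s =
    b≪a x x-chain s s-sup (⊑-trans a a' s a⊑a' a'⊑s)

  chain-mono-⊑ : (x : ℕ → Carrier) → Chain x → {i j : ℕ} → i ≤ j → x i ⊑ x j
  chain-mono-⊑ = chain-mono _⊑_ ⊑-refl ⊑-trans

  record Join (x y : Carrier) : Set where
    field
      join  : Carrier
      left  : x ⊑ join
      right : y ⊑ join
      least : (u : Carrier) → x ⊑ u → y ⊑ u → join ⊑ u
  open Join public

  -- A join is way below whatever both of its arguments are way below,
  -- because ≪-witnesses along a chain can be pushed to a common later index.
  join-≪ : {x y a : Carrier} (J : Join x y) → x ≪ a → y ≪ a → join J ≪ a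
  join-≪ {x} {y} J x≪a y≪a z z-chain s s-sup a⊑s =
    ∃̃-bind (x≪a z z-chain s s-sup a⊑s) (λ n x⊑zn →
    ∃̃-bind (y≪a z z-chain s s-sup a⊑s) (λ m y⊑zm →
    ∃̃-intro (n ⊔ m) (least J (z (n ⊔ m))
      (⊑-trans x (z n) _ x⊑zn (chain-mono-⊑ z z-chain (m≤m⊔n n m)))
      (⊑-trans y (z m) _ y⊑zm (chain-mono-⊑ z z-chain (m≤n⊔m n m))))))

  apx : Carrier → ℕ → Carrier
  apx a = proj₁ (approx a)

  apx-chain : (a : Carrier) → Chain (apx a)
  apx-chain a = proj₁ (proj₂ (approx a))

  apx-≪ : (a : Carrier) (i : ℕ) → apx a i ≪ a
  apx-≪ a = proj₁ (proj₂ (proj₂ (approx a)))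

  apx-sup : (a : Carrier) → IsSup (apx a) a
  apx-sup a = proj₂ (proj₂ (proj₂ (approx a)))

  Below : {I : Set} → (I → Carrier) → Carrier → Set
  Below g v = ∃̃ (λ i → v ≪ g i)

  WayBelowDirected : {I : Set} → (I → Carrier) → Set
  WayBelowDirected {I} g = (v w : Carrier) (i i' : I) → v ≪ g i → w ≪ g i' →
    ∃̃ (λ i'' → (v ≪ g i'') × (w ≪ g i''))

  chain-wayBelowDirected : (g : ℕ → Carrier) → Chain g → WayBelowDirected g
  chain-wayBelowDirected g g-chain v w i i' v≪gi w≪gi' = ∃̃-intro (i ⊔ i')
    ( ≪-⊑-trans v≪gi  (chain-mono-⊑ g g-chain (m≤m⊔n i i'))
    , ≪-⊑-trans w≪gi' (chain-mono-⊑ g g-chain (m≤n⊔m i i')))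

module RunningJoins (B : PredomainBase) (bc : BoundedComplete B) where
  open PredomainBase B
  open WayBelow B

  join-exists : (x y : Carrier) → ∃̃ (λ u → (x ⊑ u) × (y ⊑ u)) → Join x y
  join-exists x y bounded
    with bc (x ∷ y ∷ []) (∃̃-bind bounded (λ u xy⊑u →
           ∃̃-intro u (proj₁ xy⊑u ∷ proj₂ xy⊑u ∷ [])))
  ... | s , (x⊑s ∷ y⊑s ∷ []) , s-least =
    record { join = s ; left = x⊑s ; right = y⊑s
           ; least = λ u x⊑u y⊑u → s-least u (x⊑u ∷ y⊑u ∷ []) }

  JoinClosed : (Carrier → Set) → Set
  JoinClosed D = (v w : Carrier) → D v → D w → Σ (Join v w) (λ J → D (join J))

  below-joinClosed : {I : Set} (g : I → Carrier) → WayBelowDirected g →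
                     JoinClosed (Below g)
  below-joinClosed g directed v w v-below w-below = J , J-below
    where
    common : ∃̃ (λ i → (v ≪ g i) × (w ≪ g i))
    common = ∃̃-bind v-below (λ i v≪gi → ∃̃-bind w-below (λ i' w≪gi' →
               directed v w i i' v≪gi w≪gi'))
    J : Join v w
    J = join-exists v w (∃̃-bind common (λ i vw≪gi →
          ∃̃-intro (g i) (≪⇒⊑ (proj₁ vw≪gi) , ≪⇒⊑ (proj₂ vw≪gi))))
    J-below : Below g (join J)
    J-below = ∃̃-bind common (λ i vw≪gi →
                ∃̃-intro i (join-≪ J (proj₁ vw≪gi) (proj₂ vw≪gi)))

  -- Inside a join-closed region D, an enumerated family e of elements of D
  -- is dominated by the chain of running joins  e(σ 0) ⊔ … ⊔ e(σ n),
  -- all of which stay in D.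
  module Accumulate (D : Carrier → Set) (closed : JoinClosed D)
                    {I : Set} (enum : Enumeration I)
                    (e : I → Carrier) (e∈D : (t : I) → D (e t)) where
    private
      σ : ℕ → I
      σ = proj₁ enum

      extend : (n : ℕ) (v : Carrier) → D v →
               Σ (Join v (e (σ (suc n)))) (λ J → D (join J))
      extend n v v∈D = closed v (e (σ (suc n))) v∈D (e∈D (σ (suc n)))

      acc′ : ℕ → Σ Carrier D
      acc′ zero    = e (σ zero) , e∈D (σ zero)
      acc′ (suc n) = join (proj₁ step) , proj₂ step
        where step = extend n (proj₁ (acc′ n)) (proj₂ (acc′ n))

    acc : ℕ → Carrier
    acc n = proj₁ (acc′ n)

    acc-in : (n : ℕ) → D (acc n)
    acc-in n = proj₂ (acc′ n)

    acc-chain : Chain acc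
    acc-chain n = left (proj₁ (extend n (acc n) (acc-in n)))

    private
      acc-above : (n : ℕ) → e (σ n) ⊑ acc n
      acc-above zero    = ⊑-refl _
      acc-above (suc n) = right (proj₁ (extend n (acc n) (acc-in n)))

    acc-covers : (t : I) → ∃ (λ n → e t ⊑ acc n)
    acc-covers t with proj₂ enum t
    ... | n , refl = n , acc-above n

  -- The running joins d of the doubly indexed
  -- family apx (apx a i) j form a chain with supremum a whose members lie
  -- way below members of apx a, and b ≪ a catches some dₙ.
  interpolate : {b a : Carrier} → b ≪ a → ∃̃ (λ i → b ≪ apx a i)
  interpolate {b} {a} b≪a =
    ∃̃-bind (b≪a d d-chain a d-sup (⊑-refl a)) (λ n b⊑dn →
    ∃̃-bind (d-in n) (λ i dn≪ai → ∃̃-intro i (⊑-≪-trans b⊑dn dn≪ai)))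
    where
    e : ℕ × ℕ → Carrier
    e (i , j) = apx (apx a i) j

    e-below : (t : ℕ × ℕ) → Below (apx a) (e t)
    e-below (i , j) = ∃̃-intro i (apx-≪ (apx a i) j)

    open Accumulate (Below (apx a))
      (below-joinClosed (apx a) (chain-wayBelowDirected (apx a) (apx-chain a)))
      enumℕ² e e-below
      renaming (acc to d; acc-in to d-in; acc-chain to d-chain; acc-covers to d-covers)

    d-sup : IsSup d a
    d-sup = d⊑a , a-least
      where
      d⊑a : (n : ℕ) → d n ⊑ a
      d⊑a n = ∃̃-elim (⊑-dec (d n) a) (d-in n) (λ i dn≪ai →
                ⊑-trans _ _ a (≪⇒⊑ dn≪ai) (proj₁ (apx-sup a) i))

      e⊑ : (u : Carrier) → ((n : ℕ) → d n ⊑ u) → (t : ℕ × ℕ) → e t ⊑ u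
      e⊑ u d⊑u t with d-covers t
      ... | n , et⊑dn = ⊑-trans _ _ u et⊑dn (d⊑u n)

      a-least : (u : Carrier) → ((n : ℕ) → d n ⊑ u) → a ⊑ u
      a-least u d⊑u = proj₂ (apx-sup a) u (λ i →
        proj₂ (apx-sup (apx a i)) u (λ j → e⊑ u d⊑u (i , j)))

WayAbove : (C : PredomainBase) → PredomainBase.Carrier C → Completion C → Set
WayAbove C c z = ∃̃ (λ m → c ≪ proj₁ z m)
  where open PredomainBase C

⊑̂-refl : (C : PredomainBase) (x : Completion C) → ⊑̂ C x x
⊑̂-refl C x b n b≪xn = ∃̃-intro n b≪xn

⊑̂-trans : (C : PredomainBase) (x y z : Completion C) →
          ⊑̂ C x y → ⊑̂ C y z → ⊑̂ C x z
⊑̂-trans C x y z x⊑y y⊑z b n b≪xn = ∃̃-bind (x⊑y b n b≪xn) (y⊑z b)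

module CompletionChains (C : PredomainBase) (bc : BoundedComplete C) where
  open PredomainBase C
  open WayBelow C
  open RunningJoins C bc

  -- Every chain (xₖ) in Ĉ has an upper bound û each of whose entries is
  -- way below some entry xₖⱼ: the running joins of the family
  -- apx (xₖⱼ) i, which lies below the way-below-directed family (xₖⱼ).
  module UpperBound (x : ℕ → Completion C) (x-chain : Order.Chain (⊑̂ C) x) where
    entry : ℕ × ℕ → Carrier
    entry (k , j) = proj₁ (x k) j

    private
      x-mono : {k k' : ℕ} → k ≤ k' → ⊑̂ C (x k) (x k')
      x-mono = chain-mono (⊑̂ C) (⊑̂-refl C) (⊑̂-trans C) x x-chain

      entries-directed : WayBelowDirected entry
      entries-directed v w (k , j) (k' , j') v≪ w≪ =
        ∃̃-bind (x-mono (m≤m⊔n k k') v j v≪) (λ m v≪m →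
        ∃̃-bind (x-mono (m≤n⊔m k k') w j' w≪) (λ m' w≪m' →
        ∃̃-intro (k ⊔ k' , m ⊔ m')
          ( ≪-⊑-trans v≪m  (row-mono (m≤m⊔n m m'))
          , ≪-⊑-trans w≪m' (row-mono (m≤n⊔m m m')))))
        where
        row-mono : {i i' : ℕ} → i ≤ i' → entry (k ⊔ k' , i) ⊑ entry (k ⊔ k' , i')
        row-mono = chain-mono-⊑ (proj₁ (x (k ⊔ k'))) (proj₂ (x (k ⊔ k')))

      e : ℕ × ℕ × ℕ → Carrier
      e (k , j , i) = apx (entry (k , j)) i

      e-below : (t : ℕ × ℕ × ℕ) → Below entry (e t)
      e-below (k , j , i) = ∃̃-intro (k , j) (apx-≪ (entry (k , j)) i)

    open Accumulate (Below entry) (below-joinClosed entry entries-directed)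
      enumℕ³ e e-below
      public renaming (acc to u; acc-in to u-below)

    û : Completion C
    û = u , acc-chain

    û-upper : (k : ℕ) → ⊑̂ C (x k) û
    û-upper k b j b≪xkj = ∃̃-bind (interpolate b≪xkj) (λ i b≪apx →
      let (n , e⊑un) = acc-covers (k , j , i) in ∃̃-intro n (≪-⊑-trans b≪apx e⊑un))

  -- ↑c is Scott-open: it is an upper set, and if c ≪ sₘ for the supremum s
  -- of a chain (xₖ), then s ⊑ û yields c ≪ ûₙ ≪ xₖⱼ for some n, k, j.
  wayAbove-open : (c : Carrier) → Order.ScottOpen (⊑̂ C) (WayAbove C c)
  wayAbove-open c = upper , inaccessible
    where
    upper : (x y : Completion C) → ⊑̂ C x y → WayAbove C c x → WayAbove C c y
    upper x y x⊑y c∈x = ∃̃-bind c∈x (x⊑y c)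

    inaccessible : (x : ℕ → Completion C) → Order.Chain (⊑̂ C) x →
      (s : Completion C) → Order.IsSup (⊑̂ C) x s → WayAbove C c s →
      ∃̃ (λ k → WayAbove C c (x k))
    inaccessible x x-chain s s-sup c∈s =
      ∃̃-bind c∈s (λ m c≪sm →
      ∃̃-bind (proj₂ s-sup û û-upper c m c≪sm) (λ n c≪un →
      ∃̃-bind (u-below n) (λ { (k , j) un≪xkj →
      ∃̃-intro k (∃̃-intro j (≪-⊑-trans c≪un (≪⇒⊑ un≪xkj))) })))
      where open UpperBound x x-chain

continuous-if-basic-preimages-open : (B C : PredomainBase)
  (f : Completion B → Completion C) →
  ((c : PredomainBase.Carrier C) →
    Order.ScottOpen (⊑̂ B) (λ x → WayAbove C c (f x))) →
  ScottContinuous (⊑̂ B) (⊑̂ C) f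
continuous-if-basic-preimages-open B C f preimage-open = monotone , preserves-sup
  where
  monotone : Order.Monotone (⊑̂ B) (⊑̂ C) f
  monotone x y x⊑y c n c≪fxn =
    proj₁ (preimage-open c) x y x⊑y (∃̃-intro n c≪fxn)

  -- f s ⊑ t: if c ≪ (f s)ₙ then f(xₖ) ∈ ↑c for some k, and f(xₖ) ⊑ t;
  -- t ⊑ f s: f s bounds every f(xₙ) by monotonicity.
  preserves-sup : (x : ℕ → Completion B) → Order.Chain (⊑̂ B) x →
    (s : Completion B) → Order.IsSup (⊑̂ B) x s →
    (t : Completion C) → Order.IsSup (⊑̂ C) (λ n → f (x n)) t →
    ⊑̂ C (f s) t × ⊑̂ C t (f s)
  preserves-sup x x-chain s s-sup t t-sup =
    (λ c n c≪fsn →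
      ∃̃-bind (proj₂ (preimage-open c) x x-chain s s-sup (∃̃-intro n c≪fsn))
        (λ k c∈fxk → ∃̃-bind c∈fxk (proj₁ t-sup k c))) ,
    proj₂ t-sup (f s) (λ n → monotone (x n) s (proj₁ s-sup n))

lemma4p7 : (B C : PredomainBase) → BoundedComplete B → BoundedComplete C →
    WayBelowDecidable C →
    (f : Completion B → Completion C) → RespectsEq B C f →
    ((O : Completion C → Set) → Order.ScottOpen (⊑̂ C) O →
      Order.ScottOpen (⊑̂ B) (λ x → O (f x))) →
    ScottContinuous (⊑̂ B) (⊑̂ C) f
lemma4p7 B C _ bcC _ f _ preimage-open =
  continuous-if-basic-preimages-open B C f
    (λ c → preimage-open (WayAbove C c) (wayAbove-open c))
  where open CompletionChains C bcC
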